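{- Let $c\ge1$ and let $\mathcal F_1,\ldots,\mathcal F_c$ be finite families of finite graphs, and let $R_{\mathrm{cl}}(\mathcal F_1,\ldots,\mathcal F_c)$ be the least $R$ such that every coloring of the edges of $K_R$ with colors $1,\ldots,c$ contains, for some $i$, a subgraph isomorphic to a member of $\mathcal F_i$ all of whose edges have color $i$ (assume this number exists). Let $H$ be a finite graph with a clique $C\subseteq V(H)$, $|C|=r$, and a map $\lambda:V(H)\to C$ that is the identity on $C$ and injective on every clique of $H$. If $r\ge R_{\mathrm{cl}}(\mathcal F_1,\ldots,\mathcal F_c)$, then every coloring of $E(H)$ with colors $1,\ldots,c$ contains, for some $i$, a subgraph of $H$ isomorphic to a member of $\mathcal F_i$ with all edges of color $i$. If moreover every graph in every $\mathcal F_i$ is complete, then the condition $r\ge R_{\mathrm{cl}}(\mathcal F_1,\ldots,\mathcal F_c)$ is also necessary for this conclusion. -}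

module Defs where

open import Data.Nat using (ℕ; _≤_; _<_)
open import Data.Fin using (Fin)
open import Data.Fin.Subset using (Subset; _∈_)
open import Data.Bool using (Bool; true; false)
open import Data.List using (List)
open import Data.List.Membership.Propositional using () renaming (_∈_ to _∈ₗ_)
open import Data.Product using (Σ; ∃; _×_)
open import Relation.Binary.PropositionalEquality using (_≡_; _≢_)
open import Relation.Nullary using (¬_)

record Graph : Set where
  field
    n      : ℕ
    adj    : Fin n → Fin n → Bool
    sym    : ∀ u v → adj u v ≡ adj v u
    irrefl : ∀ v → adj v v ≡ false

open Graph public

Edge : (G : Graph) → Fin (n G) → Fin (n G) → Set
Edge G u v = adj G u v ≡ true

K : ℕ → Graph
K R = record
  { n = R
  ; adj = λ u v → not≡ u v
  ; sym = λ u v → sym≡ u v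
  ; irrefl = λ v → irr≡ v
  }
  where
  open import Data.Fin using (_≟_)
  open import Relation.Nullary using (yes; no)
  open import Relation.Binary.PropositionalEquality using (refl) renaming (sym to ≡sym)
  not≡ : Fin R → Fin R → Bool
  not≡ u v with u ≟ v
  ... | yes _ = false
  ... | no _ = true
  sym≡ : ∀ u v → not≡ u v ≡ not≡ v u
  sym≡ u v with u ≟ v | v ≟ u
  ... | yes _ | yes _ = refl
  ... | no _ | no _ = refl
  ... | yes p | no q with q (≡sym p)
  ... | ()
  sym≡ u v | no q | yes p with q (≡sym p)
  ... | ()
  irr≡ : ∀ v → not≡ v v ≡ false
  irr≡ v with v ≟ v
  ... | yes _ = refl
  ... | no q with q refl
  ... | ()

IsComplete : Graph → Set
IsComplete G = ∀ u v → u ≢ v → Edge G u v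

-- A coloring of the edges of G with colors Fin c (values on non-edges are irrelevant;
-- the colour of an edge must not depend on the orientation).
record Coloring (c : ℕ) (G : Graph) : Set where
  field
    col : Fin (n G) → Fin (n G) → Fin c
    col-sym : ∀ u v → Edge G u v → col u v ≡ col v u

open Coloring public

MonoCopy : ∀ {c} (G : Graph) → Coloring c G → Fin c → Graph → Set
MonoCopy G χ i F =
  Σ (Fin (n F) → Fin (n G)) λ φ →
    (∀ u v → φ u ≡ φ v → u ≡ v) ×
    (∀ u v → Edge F u v → Edge G (φ u) (φ v) × col χ (φ u) (φ v) ≡ i)

Arrows : ∀ {c} → Graph → (Fin c → List Graph) → Set
Arrows {c} G 𝓕 = (χ : Coloring c G) →
  ∃ λ i → ∃ λ F → (F ∈ₗ 𝓕 i) × MonoCopy G χ i F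

IsRcl : ∀ {c} → (Fin c → List Graph) → ℕ → Set
IsRcl 𝓕 R = Arrows (K R) 𝓕 × (∀ R' → R' < R → ¬ Arrows (K R') 𝓕)

IsClique : (G : Graph) → Subset (n G) → Set
IsClique G S = ∀ u v → u ∈ S → v ∈ S → u ≢ v → Edge G u v

InjectiveOn : ∀ {m k} → (Fin m → Fin k) → Subset m → Set
InjectiveOn f S = ∀ u v → u ∈ S → v ∈ S → f u ≡ f v → u ≡ v

{-# OPTIONS --safe #-}
module Submission where

open import Defs
open import Data.Nat using (ℕ; _≤_)
open import Data.Fin using (Fin)
open import Data.Fin.Subset using (Subset; _∈_; ∣_∣)
open import Data.List using (List)
open import Data.List.Membership.Propositional using () renaming (_∈_ to _∈ₗ_)
open import Data.Product using (_×_)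
open import Relation.Binary.PropositionalEquality using (_≡_)

open import Data.Nat.Properties using (≮⇒≥)
open import Data.Fin using (zero; suc; inject≤; _≟_)
open import Data.Fin.Properties using (suc-injective; inject≤-injective; any?)
open import Data.Fin.Subset using (inside; outside)
open import Data.Vec using ([]; _∷_; tabulate; here; there)
open import Data.Vec.Properties using (lookup∘tabulate; []=⇒lookup; lookup⇒[]=)
open import Data.Product using (∃; _,_; proj₁; proj₂; map; map₂)
open import Function using (_∘_)
open import Function.Definitions using (Injective)
open import Relation.Nullary using (yes; no; does; contradiction)
open import Relation.Nullary.Decidable using (dec-true)
open import Relation.Binary.PropositionalEquality
  using (_≢_; refl; trans; cong; module ≡-Reasoning) renaming (sym to ≡-sym)

-- Sufficiency: the clique C spans a copy of K_r ⊇ K_R in H, so a colouring of H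
-- restricts to one of K_R, and a monochromatic copy found there lies in H.
-- Necessity: λ', read as a map into the r vertices of C, is a homomorphism H → K_r that
-- is injective on cliques.  A colouring of K_r pulls back along it to H; a
-- monochromatic complete graph in H is a clique, so λ' maps it injectively onto a
-- monochromatic copy in K_r.  Hence K_r → (𝓕₁,…,𝓕_c), and r ≥ R by minimality of R.

edge⇒≢ : ∀ G {u v} → Edge G u v → u ≢ v
edge⇒≢ G {u} e refl with trans (≡-sym e) (irrefl G u)
... | ()

≢⇒Edge-K : ∀ r {a b : Fin r} → a ≢ b → Edge (K r) a b
≢⇒Edge-K r {a} {b} a≢b with a ≟ b
... | yes a≡b = contradiction a≡b a≢b
... | no _ = refl

record Hom (G H : Graph) : Set where
  field
    vertex : Fin (n G) → Fin (n H)
    edge   : ∀ {u v} → Edge G u v → Edge H (vertex u) (vertex v)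

open Hom

pullback : ∀ {c G H} → Hom G H → Coloring c H → Coloring c G
pullback h χ = record
  { col     = λ u v → col χ (vertex h u) (vertex h v)
  ; col-sym = λ u v → col-sym χ (vertex h u) (vertex h v) ∘ edge h
  }

MonoCopy-pushforward : ∀ {c G H i F} (h : Hom G H) (χ : Coloring c H)
  (copy : MonoCopy G (pullback h χ) i F) → Injective _≡_ _≡_ (vertex h ∘ proj₁ copy) →
  MonoCopy H χ i F
MonoCopy-pushforward h χ (φ , _ , φ-edge) hφ-injective =
  vertex h ∘ φ , (λ u v → hφ-injective) ,
  λ u v e → edge h (proj₁ (φ-edge u v e)) , proj₂ (φ-edge u v e)

Arrows-embedding : ∀ {c G H} {𝓕 : Fin c → List Graph} (h : Hom G H) →
  Injective _≡_ _≡_ (vertex h) → Arrows G 𝓕 → Arrows H 𝓕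
Arrows-embedding h h-injective G→𝓕 χ with G→𝓕 (pullback h χ)
... | i , F , F∈𝓕 , copy@(_ , φ-injective , _) =
  i , F , F∈𝓕 , MonoCopy-pushforward {i = i} {F = F} h χ copy (λ {u v} → φ-injective u v ∘ h-injective)

image : ∀ {m k} → (Fin m → Fin k) → Subset k
image φ = tabulate λ w → does (any? λ x → φ x ≟ w)

∈-image : ∀ {m k} (φ : Fin m → Fin k) x → φ x ∈ image φ
∈-image φ x = lookup⇒[]= (φ x) (image φ)
  (trans (lookup∘tabulate _ (φ x)) (dec-true (any? λ y → φ y ≟ φ x) (x , refl)))

∈-image⁻ : ∀ {m k} (φ : Fin m → Fin k) {w} → w ∈ image φ → ∃ λ x → φ x ≡ w
∈-image⁻ φ {w} w∈ with any? (λ x → φ x ≟ w) | trans (≡-sym (lookup∘tabulate _ w)) ([]=⇒lookup w∈)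
... | yes preimage | _ = preimage
... | no _         | ()

image-isClique : ∀ H {m} (φ : Fin m → Fin (n H)) →
  (∀ {x y} → x ≢ y → Edge H (φ x) (φ y)) → IsClique H (image φ)
image-isClique H φ φ-edge u v u∈ v∈ u≢v with ∈-image⁻ φ u∈ | ∈-image⁻ φ v∈
... | x , refl | y , refl = φ-edge (u≢v ∘ cong φ)

CliqueInjective : ∀ H {k} → (Fin (n H) → Fin k) → Set
CliqueInjective H f = ∀ S → IsClique H S → InjectiveOn f S

CliqueInjective⇒edge-≢ : ∀ H {k} {f : Fin (n H) → Fin k} → CliqueInjective H f →
  ∀ {u v} → Edge H u v → f u ≢ f v
CliqueInjective⇒edge-≢ H f-injective {u} {v} e =
  edge⇒≢ H e ∘ f-injective (image ends) (image-isClique H ends ends-edge)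
                           u v (∈-image ends zero) (∈-image ends (suc zero))
  where
  ends : Fin 2 → Fin (n H)
  ends zero    = u
  ends (suc _) = v

  ends-edge : ∀ {x y} → x ≢ y → Edge H (ends x) (ends y)
  ends-edge {zero}       {zero}       x≢y = contradiction refl x≢y
  ends-edge {zero}       {suc _}      _   = e
  ends-edge {suc _}      {zero}       _   = trans (Graph.sym H v u) e
  ends-edge {suc zero}   {suc zero}   x≢y = contradiction refl x≢y

Arrows-collapse : ∀ {c G H} {𝓕 : Fin c → List Graph} (h : Hom H G) →
  CliqueInjective H (vertex h) → (∀ i F → F ∈ₗ 𝓕 i → IsComplete F) →
  Arrows H 𝓕 → Arrows G 𝓕
Arrows-collapse {H = H} h h-injective complete H→𝓕 ψ with H→𝓕 (pullback h ψ)
... | i , F , F∈𝓕 , copy@(φ , φ-injective , φ-edge) =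
  i , F , F∈𝓕 , MonoCopy-pushforward {i = i} {F = F} h ψ copy hφ-injective
  where
  φ-edge-≢ : ∀ {x y} → x ≢ y → Edge H (φ x) (φ y)
  φ-edge-≢ x≢y = proj₁ (φ-edge _ _ (complete i F F∈𝓕 _ _ x≢y))

  hφ-injective : Injective _≡_ _≡_ (vertex h ∘ φ)
  hφ-injective {x} {y} =
    φ-injective x y ∘ h-injective (image φ) (image-isClique H φ φ-edge-≢)
                                  (φ x) (φ y) (∈-image φ x) (∈-image φ y)

Hom-to-K : ∀ H {k} (f : Fin (n H) → Fin k) → (∀ {u v} → Edge H u v → f u ≢ f v) → Hom H (K k)
Hom-to-K H {k} f f-edge = record { vertex = f ; edge = ≢⇒Edge-K k ∘ f-edge }

Hom-from-clique : ∀ H {m S} (f : Fin m → Fin (n H)) → Injective _≡_ _≡_ f → (∀ a → f a ∈ S) →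
  IsClique H S → Hom (K m) H
Hom-from-clique H {m} f f-injective f∈S S-clique = record
  { vertex = f
  ; edge   = λ {a} {b} e → S-clique (f a) (f b) (f∈S a) (f∈S b) (edge⇒≢ (K m) e ∘ f-injective)
  }

record Enumeration {m} (S : Subset m) : Set where
  field
    elem           : Fin ∣ S ∣ → Fin m
    elem∈          : ∀ a → elem a ∈ S
    elem-injective : Injective _≡_ _≡_ elem
    elem-onto      : ∀ {w} → w ∈ S → ∃ λ a → elem a ≡ w

enumerate : ∀ {m} (S : Subset m) → Enumeration S
enumerate [] = record { elem = λ () ; elem∈ = λ () ; elem-injective = λ {} ; elem-onto = λ () }
enumerate (outside ∷ S) = record
  { elem           = suc ∘ elem
  ; elem∈          = there ∘ elem∈
  ; elem-injective = elem-injective ∘ suc-injective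
  ; elem-onto      = λ { (there w∈S) → map₂ (cong suc) (elem-onto w∈S) }
  }
  where open Enumeration (enumerate S)
enumerate (inside ∷ S) = record
  { elem           = elem′
  ; elem∈          = elem′∈
  ; elem-injective = elem′-injective
  ; elem-onto      = elem′-onto
  }
  where
  open Enumeration (enumerate S)

  elem′ : Fin ∣ inside ∷ S ∣ → Fin _
  elem′ zero    = zero
  elem′ (suc a) = suc (elem a)

  elem′∈ : ∀ a → elem′ a ∈ (inside ∷ S)
  elem′∈ zero    = here
  elem′∈ (suc a) = there (elem∈ a)

  elem′-injective : Injective _≡_ _≡_ elem′
  elem′-injective {zero}  {zero}  _  = refl
  elem′-injective {suc a} {suc b} eq = cong suc (elem-injective (suc-injective eq))

  elem′-onto : ∀ {w} → w ∈ (inside ∷ S) → ∃ λ a → elem′ a ≡ w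
  elem′-onto here          = zero , refl
  elem′-onto (there w∈S) = map suc (cong suc) (elem-onto w∈S)

proposition4p6 : (c : ℕ) → 1 ≤ c → (𝓕 : Fin c → List Graph) → (R : ℕ) → IsRcl 𝓕 R →
    (H : Graph) (r : ℕ) (C : Subset (n H)) → IsClique H C → ∣ C ∣ ≡ r →
    (λ' : Fin (n H) → Fin (n H)) → (∀ v → λ' v ∈ C) → (∀ v → v ∈ C → λ' v ≡ v) →
    (∀ K → IsClique H K → InjectiveOn λ' K) →
    (R ≤ r → Arrows H 𝓕) ×
    ((∀ i F → F ∈ₗ 𝓕 i → IsComplete F) → Arrows H 𝓕 → R ≤ r)
proposition4p6 c _ 𝓕 R (K-R→𝓕 , R-minimal) H .(∣ C ∣) C C-clique refl λ' λ'∈C _ λ'-injective =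
  sufficiency , necessity
  where
  open Enumeration (enumerate C)
  open ≡-Reasoning

  sufficiency : R ≤ ∣ C ∣ → Arrows H 𝓕
  sufficiency R≤r = Arrows-embedding (Hom-from-clique H embed embed-injective (elem∈ ∘ inject≤′) C-clique)
                                     embed-injective K-R→𝓕
    where
    inject≤′ : Fin R → Fin ∣ C ∣
    inject≤′ a = inject≤ a R≤r

    embed : Fin R → Fin (n H)
    embed = elem ∘ inject≤′

    embed-injective : Injective _≡_ _≡_ embed
    embed-injective = inject≤-injective R≤r R≤r _ _ ∘ elem-injective

  index : Fin (n H) → Fin ∣ C ∣
  index v = proj₁ (elem-onto (λ'∈C v))

  elem-index : ∀ v → elem (index v) ≡ λ' v
  elem-index v = proj₂ (elem-onto (λ'∈C v))

  index-cliqueInjective : CliqueInjective H index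
  index-cliqueInjective S S-clique u v u∈S v∈S index-u≡index-v =
    λ'-injective S S-clique u v u∈S v∈S (begin
      λ' u             ≡⟨ ≡-sym (elem-index u) ⟩
      elem (index u)   ≡⟨ cong elem index-u≡index-v ⟩
      elem (index v)   ≡⟨ elem-index v ⟩
      λ' v             ∎)

  necessity : (∀ i F → F ∈ₗ 𝓕 i → IsComplete F) → Arrows H 𝓕 → R ≤ ∣ C ∣
  necessity complete H→𝓕 = ≮⇒≥ λ r<R → R-minimal ∣ C ∣ r<R
    (Arrows-collapse (Hom-to-K H index (CliqueInjective⇒edge-≢ H index-cliqueInjective))
                     index-cliqueInjective complete H→𝓕)
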